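{- Let $m,u$ be positive integers, $\alpha=m/\gcd(m,u)$, $\beta=\gcd(m,u)$, and $\lambda_m=e^{2\pi i/m}$. Then, as rational functions of $z$, $$F_m(1,\lambda_m^u,z)=\frac{(1-(-z)^\alpha)^\beta}{1+z}.$$
   Context: For $m\ge2$, $F_m(x,y,z)=\prod_{j=1}^{m-1}(x+zy^j)$, and by convention $F_1(x,y,z)=1$. -}

module Defs where

open import Data.Nat using (ℕ; zero; suc; _∸_)
open import Algebra.Bundles using (CommutativeRing)

module _ {c ℓ} (R : CommutativeRing c ℓ) where
  open CommutativeRing R

  pow : Carrier → ℕ → Carrier
  pow x zero    = 1#
  pow x (suc n) = x * pow x n

  prodFrom1 : ℕ → (ℕ → Carrier) → Carrier
  prodFrom1 zero    f = 1#
  prodFrom1 (suc n) f = prodFrom1 n f * f (suc n)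

  F : ℕ → Carrier → Carrier → Carrier → Carrier
  F m x y z = prodFrom1 (m ∸ 1) (λ j → x + z * pow y j)

module Submission where

-- Write η = ζᵘ.  Since ζ has exact order m = α·β and β = gcd(m,u),
-- η has exact order α, and (1 + z)·F_m(1, η, z) = ∏_{j<m} (1 + z ηʲ) splits into
-- β periods of length α, so it equals (∏_{j<α} (1 + z ηʲ))^β.  The key fact is
--   ∏_{j<α} (1 + z ηʲ) = 1 - (-z)ᵅ    (η of exact order α, integral domain),
-- proved on coefficient sequences: expanding the product as Σ cₖ Xᵏ, replacing
-- X by ηX only permutes the factors, so ηᵏ cₖ = cₖ; as ηᵏ ≠ 1 for 0 < k < α, the
-- middle coefficients vanish, c₀ = 1, and evaluating at X = -1 (where the
-- factor j = 0 vanishes) gives cₐ·(-1)ᵅ = -1.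

open import Defs

open import Level using (Level; _⊔_)
open import Function using (_∘_)
open import Data.Empty using (⊥-elim)
open import Data.Product using (_×_; _,_; proj₁)
open import Data.Sum using (_⊎_; inj₁; inj₂)
open import Data.Nat as ℕ using (ℕ; zero; suc; _<_; NonZero; s≤s; z≤n)
import Data.Nat.Properties as ℕₚ
open import Data.Nat.Divisibility using (_∣_; divides; m%n≡0⇒n∣m; *-cancelʳ-∣; ∣⇒≤)
open import Data.Nat.DivMod using (_%_; _/_; m≡m%n+[m/n]*n; m%n<n)
open import Data.Nat.GCD using (gcd; GCD; gcd[m,n]∣n; gcd-GCD; GCD-*)
open import Data.Nat.Coprimality using (Coprime; GCD≡1⇒coprime; coprime-divisor)
open import Relation.Nullary using (¬_; yes; no)
open import Relation.Binary.PropositionalEquality as ≡ using (_≡_)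
open import Algebra.Bundles using (CommutativeRing)

cofactors-coprime : ∀ {m u α u' β} .{{_ : NonZero β}} →
  β ≡ gcd m u → α ℕ.* β ≡ m → u ≡ u' ℕ.* β → Coprime α u'
cofactors-coprime {m} {u} {α} {u'} {β} β≡gcd αβ≡m u≡u'β =
  GCD≡1⇒coprime (GCD-* (≡.subst₂ (λ a b → GCD a b (1 ℕ.* β)) (≡.sym αβ≡m) u≡u'β gcdGCD))
  where
  gcdGCD : GCD m u (1 ℕ.* β)
  gcdGCD = ≡.subst (GCD m u) (≡.trans (≡.sym β≡gcd) (≡.sym (ℕₚ.*-identityˡ β))) (gcd-GCD m u)

module RootsOfUnity {c ℓ} (R : CommutativeRing c ℓ) where
  open CommutativeRing R hiding (zero)
  open import Relation.Binary.Reasoning.Setoid setoid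
  open import Algebra.Solver.Ring.NaturalCoefficients.Default commutativeSemiring
  open import Algebra.Properties.Ring ring
    using (-1*x≈-x; -‿involutive; +-inverseʳ-unique; x∙y⁻¹≈ε⇒x≈y; [y-z]x≈yx-zx)
  open import Algebra.Properties.CommutativeSemiring.Exp commutativeSemiring
    using (_^_; ^-congˡ; ^-homo-*; ^-assocʳ; ^-distrib-*)

  pow≡^ : ∀ x n → pow R x n ≡ x ^ n
  pow≡^ x zero    = ≡.refl
  pow≡^ x (suc n) = ≡.cong (x *_) (pow≡^ x n)

  pow-cong : ∀ {x y} n → x ≈ y → pow R x n ≈ pow R y n
  pow-cong {x} {y} n x≈y rewrite pow≡^ x n | pow≡^ y n = ^-congˡ n x≈y

  pow-+ : ∀ x a b → pow R x (a ℕ.+ b) ≈ pow R x a * pow R x b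
  pow-+ x a b rewrite pow≡^ x (a ℕ.+ b) | pow≡^ x a | pow≡^ x b = ^-homo-* x a b

  pow-pow : ∀ x a b → pow R (pow R x a) b ≈ pow R x (a ℕ.* b)
  pow-pow x a b rewrite pow≡^ (pow R x a) b | pow≡^ x a | pow≡^ x (a ℕ.* b) = ^-assocʳ x a b

  pow-* : ∀ x y n → pow R (x * y) n ≈ pow R x n * pow R y n
  pow-* x y n rewrite pow≡^ (x * y) n | pow≡^ x n | pow≡^ y n = ^-distrib-* x y n

  -- 1ⁿ = 1, read off from (x⁰)ⁿ = x⁰.
  pow-1# : ∀ n → pow R 1# n ≈ 1#
  pow-1# n = pow-pow 1# 0 n

  pow-[-1]-square : ∀ n → pow R (- 1#) n * pow R (- 1#) n ≈ 1#
  pow-[-1]-square n = begin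
    pow R (- 1#) n * pow R (- 1#) n  ≈⟨ pow-* (- 1#) (- 1#) n ⟨
    pow R (- 1# * - 1#) n            ≈⟨ pow-cong n (trans (-1*x≈-x (- 1#)) (-‿involutive 1#)) ⟩
    pow R 1# n                       ≈⟨ pow-1# n ⟩
    1#                               ∎

  ∏< : ℕ → (ℕ → Carrier) → Carrier
  ∏< zero    f = 1#
  ∏< (suc n) f = ∏< n f * f n

  ∏<-cong : ∀ n {f g} → (∀ j → f j ≈ g j) → ∏< n f ≈ ∏< n g
  ∏<-cong zero    f≈g = refl
  ∏<-cong (suc n) f≈g = *-cong (∏<-cong n f≈g) (f≈g n)

  prodFrom1-∏< : ∀ n f → f 0 * prodFrom1 R n f ≈ ∏< (suc n) f
  prodFrom1-∏< zero    f = *-comm (f 0) 1#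
  prodFrom1-∏< (suc n) f =
    trans (sym (*-assoc (f 0) _ _)) (*-cong (prodFrom1-∏< n f) refl)

  ∏<-+ : ∀ k n f → ∏< (k ℕ.+ n) f ≈ ∏< k f * ∏< n (λ j → f (k ℕ.+ j))
  ∏<-+ k zero    f rewrite ℕₚ.+-identityʳ k = sym (*-identityʳ (∏< k f))
  ∏<-+ k (suc n) f rewrite ℕₚ.+-suc k n = begin
    ∏< (k ℕ.+ n) f * f (k ℕ.+ n)                          ≈⟨ *-cong (∏<-+ k n f) refl ⟩
    (∏< k f * ∏< n (λ j → f (k ℕ.+ j))) * f (k ℕ.+ n)     ≈⟨ *-assoc _ _ _ ⟩
    ∏< k f * (∏< n (λ j → f (k ℕ.+ j)) * f (k ℕ.+ n))     ∎

  ∏<-periodic : ∀ k f → (∀ j → f (k ℕ.+ j) ≈ f j) → ∀ b → ∏< (b ℕ.* k) f ≈ pow R (∏< k f) b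
  ∏<-periodic k f periodic zero    = refl
  ∏<-periodic k f periodic (suc b) = begin
    ∏< (k ℕ.+ b ℕ.* k) f                               ≈⟨ ∏<-+ k (b ℕ.* k) f ⟩
    ∏< k f * ∏< (b ℕ.* k) (λ j → f (k ℕ.+ j))          ≈⟨ *-cong refl (∏<-cong (b ℕ.* k) periodic) ⟩
    ∏< k f * ∏< (b ℕ.* k) f                            ≈⟨ *-cong refl (∏<-periodic k f periodic b) ⟩
    ∏< k f * pow R (∏< k f) b                          ∎

  ∏<-vanishes : ∀ n f → f 0 ≈ 0# → ∏< (suc n) f ≈ 0#
  ∏<-vanishes zero    f f0≈0 = trans (*-cong refl f0≈0) (zeroʳ 1#)
  ∏<-vanishes (suc n) f f0≈0 = trans (*-cong (∏<-vanishes n f f0≈0) refl) (zeroˡ _)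

  Poly : Set c
  Poly = ℕ → Carrier

  _≋_ : Poly → Poly → Set ℓ
  p ≋ q = ∀ k → p k ≈ q k

  ≋-trans : ∀ {p q r} → p ≋ q → q ≋ r → p ≋ r
  ≋-trans p≋q q≋r k = trans (p≋q k) (q≋r k)

  one : Poly
  one zero    = 1#
  one (suc k) = 0#

  -- Coefficients of (1 + aX) · p.
  linearTimes : Carrier → Poly → Poly
  linearTimes a p zero    = p zero
  linearTimes a p (suc k) = p (suc k) + a * p k

  linearTimes-cong : ∀ {a b p q} → a ≈ b → p ≋ q → linearTimes a p ≋ linearTimes b q
  linearTimes-cong a≈b p≋q zero    = p≋q zero
  linearTimes-cong a≈b p≋q (suc k) = +-cong (p≋q (suc k)) (*-cong a≈b (p≋q k))

  linearTimes-comm : ∀ a b p → linearTimes a (linearTimes b p) ≋ linearTimes b (linearTimes a p)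
  linearTimes-comm a b p zero          = refl
  linearTimes-comm a b p (suc zero)    =
    solve 4 (λ a b x y → (x :+ b :* y) :+ a :* y := (x :+ a :* y) :+ b :* y)
      refl a b (p 1) (p 0)
  linearTimes-comm a b p (suc (suc k)) =
    solve 5 (λ a b x y w → (x :+ b :* y) :+ a :* (y :+ b :* w) := (x :+ a :* y) :+ b :* (y :+ a :* w))
      refl a b (p (suc (suc k))) (p (suc k)) (p k)

  -- Coefficients of ∏_{j<n} (1 + g j · X); the k-th one is the k-th
  -- elementary symmetric function of g 0, …, g (n - 1).
  linearProduct : (ℕ → Carrier) → ℕ → Poly
  linearProduct g zero    = one
  linearProduct g (suc n) = linearTimes (g n) (linearProduct g n)

  linearProduct-cong : ∀ {g h} → (∀ j → g j ≈ h j) → ∀ n → linearProduct g n ≋ linearProduct h n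
  linearProduct-cong g≈h zero    k = refl
  linearProduct-cong g≈h (suc n)   = linearTimes-cong (g≈h n) (linearProduct-cong g≈h n)

  -- The factors commute, so the first one may be split off instead of the last.
  linearProduct-first : ∀ g n → linearProduct g (suc n) ≋ linearTimes (g 0) (linearProduct (g ∘ suc) n)
  linearProduct-first g zero    k = refl
  linearProduct-first g (suc n)   =
    ≋-trans (linearTimes-cong refl (linearProduct-first g n))
            (linearTimes-comm (g (suc n)) (g 0) (linearProduct (g ∘ suc) n))

  linearProduct-scale : ∀ a g n k →
    linearProduct (λ j → a * g j) n k ≈ pow R a k * linearProduct g n k
  linearProduct-scale a g zero    zero    = sym (*-identityˡ 1#)
  linearProduct-scale a g zero    (suc k) = sym (zeroʳ _)
  linearProduct-scale a g (suc n) zero    = linearProduct-scale a g n zero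
  linearProduct-scale a g (suc n) (suc k) = begin
    p' (suc k) + (a * g n) * p' k
      ≈⟨ +-cong (linearProduct-scale a g n (suc k)) (*-cong refl (linearProduct-scale a g n k)) ⟩
    (a * pow R a k) * p (suc k) + (a * g n) * (pow R a k * p k)
      ≈⟨ solve 5 (λ a b x y w → (a :* b) :* x :+ (a :* y) :* (b :* w) := (a :* b) :* (x :+ y :* w))
           refl a (pow R a k) (p (suc k)) (g n) (p k) ⟩
    (a * pow R a k) * (p (suc k) + g n * p k) ∎
    where
    p p' : Poly
    p  = linearProduct g n
    p' = linearProduct (λ j → a * g j) n

  linearProduct-constant : ∀ g n → linearProduct g n 0 ≈ 1#
  linearProduct-constant g zero    = refl
  linearProduct-constant g (suc n) = linearProduct-constant g n

  linearProduct-degree : ∀ g n k → n < k → linearProduct g n k ≈ 0#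
  linearProduct-degree g zero    (suc k) _         = refl
  linearProduct-degree g (suc n) (suc k) (s≤s n<k) =
    trans (+-cong (linearProduct-degree g n (suc k) (ℕₚ.m<n⇒m<1+n n<k))
                  (*-cong refl (linearProduct-degree g n k n<k)))
          (trans (+-cong refl (zeroʳ _)) (+-identityʳ 0#))

  -- Evaluation: eval N p z = Σ_{k<N} p k · zᵏ, by Horner's rule.

  eval : ℕ → Poly → Carrier → Carrier
  eval zero    p z = 0#
  eval (suc N) p z = p 0 + z * eval N (p ∘ suc) z

  eval-linear : ∀ N p q a z →
    eval N (λ k → p k + a * q k) z ≈ eval N p z + a * eval N q z
  eval-linear zero    p q a z = sym (trans (+-cong refl (zeroʳ a)) (+-identityʳ 0#))
  eval-linear (suc N) p q a z = begin
    (p 0 + a * q 0) + z * eval N (λ k → p (suc k) + a * q (suc k)) z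
      ≈⟨ +-cong refl (*-cong refl (eval-linear N (p ∘ suc) (q ∘ suc) a z)) ⟩
    (p 0 + a * q 0) + z * (eval N (p ∘ suc) z + a * eval N (q ∘ suc) z)
      ≈⟨ solve 6 (λ x y a z s t → (x :+ a :* y) :+ z :* (s :+ a :* t) := (x :+ z :* s) :+ a :* (y :+ z :* t))
           refl (p 0) (q 0) a z (eval N (p ∘ suc) z) (eval N (q ∘ suc) z) ⟩
    (p 0 + z * eval N (p ∘ suc) z) + a * (q 0 + z * eval N (q ∘ suc) z) ∎

  eval-last : ∀ N p z → eval (suc N) p z ≈ eval N p z + p N * pow R z N
  eval-last zero    p z =
    trans (+-cong refl (zeroʳ z))
          (trans (+-identityʳ (p 0)) (trans (sym (*-identityʳ (p 0))) (sym (+-identityˡ _))))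
  eval-last (suc N) p z = begin
    p 0 + z * eval (suc N) (p ∘ suc) z
      ≈⟨ +-cong refl (*-cong refl (eval-last N (p ∘ suc) z)) ⟩
    p 0 + z * (eval N (p ∘ suc) z + p (suc N) * pow R z N)
      ≈⟨ solve 5 (λ a z x b w → a :+ z :* (x :+ b :* w) := (a :+ z :* x) :+ b :* (z :* w))
           refl (p 0) z (eval N (p ∘ suc) z) (p (suc N)) (pow R z N) ⟩
    (p 0 + z * eval N (p ∘ suc) z) + p (suc N) * (z * pow R z N) ∎

  eval-dropTop : ∀ N p z → p N ≈ 0# → eval (suc N) p z ≈ eval N p z
  eval-dropTop N p z pN≈0 =
    trans (eval-last N p z) (trans (+-cong refl (trans (*-cong pN≈0 refl) (zeroˡ _))) (+-identityʳ _))

  eval-constant : ∀ N p z → (∀ k → 0 < k → k < suc N → p k ≈ 0#) → eval (suc N) p z ≈ p 0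
  eval-constant zero    p z _   = trans (+-cong refl (zeroʳ z)) (+-identityʳ (p 0))
  eval-constant (suc N) p z gap =
    trans (eval-dropTop (suc N) p z (gap (suc N) (s≤s z≤n) (ℕₚ.n<1+n (suc N))))
          (eval-constant N p z (λ k 0<k k<1+N → gap k 0<k (ℕₚ.m<n⇒m<1+n k<1+N)))

  eval-linearTimes : ∀ N a p z → p N ≈ 0# →
    eval (suc N) (linearTimes a p) z ≈ (1# + z * a) * eval N p z
  eval-linearTimes N a p z pN≈0 = begin
    p 0 + z * eval N (λ k → p (suc k) + a * p k) z
      ≈⟨ +-cong refl (*-cong refl (eval-linear N (p ∘ suc) p a z)) ⟩
    p 0 + z * (eval N (p ∘ suc) z + a * eval N p z)
      ≈⟨ solve 5 (λ b z x a e → b :+ z :* (x :+ a :* e) := (b :+ z :* x) :+ z :* a :* e)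
           refl (p 0) z (eval N (p ∘ suc) z) a (eval N p z) ⟩
    eval (suc N) p z + z * a * eval N p z
      ≈⟨ +-cong (trans (eval-dropTop N p z pN≈0) (sym (*-identityˡ _))) refl ⟩
    1# * eval N p z + z * a * eval N p z
      ≈⟨ distribʳ (eval N p z) 1# (z * a) ⟨
    (1# + z * a) * eval N p z ∎

  eval-linearProduct : ∀ g n z → eval (suc n) (linearProduct g n) z ≈ ∏< n (λ j → 1# + z * g j)
  eval-linearProduct g zero    z = trans (+-cong refl (zeroʳ z)) (+-identityʳ 1#)
  eval-linearProduct g (suc n) z = begin
    eval (suc (suc n)) (linearTimes (g n) (linearProduct g n)) z
      ≈⟨ eval-linearTimes (suc n) (g n) (linearProduct g n) z
           (linearProduct-degree g n (suc n) (ℕₚ.n<1+n n)) ⟩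
    (1# + z * g n) * eval (suc n) (linearProduct g n) z
      ≈⟨ *-cong refl (eval-linearProduct g n z) ⟩
    (1# + z * g n) * ∏< n (λ j → 1# + z * g j)
      ≈⟨ *-comm _ _ ⟩
    ∏< n (λ j → 1# + z * g j) * (1# + z * g n) ∎

  linearProduct-sparse : ∀ g n →
    (∀ k → 0 < k → k < suc n → linearProduct g (suc n) k ≈ 0#) →
    ∀ w → ∏< (suc n) (λ j → 1# + w * g j) ≈ 1# + linearProduct g (suc n) (suc n) * pow R w (suc n)
  linearProduct-sparse g n gap w = begin
    ∏< (suc n) (λ j → 1# + w * g j)     ≈⟨ eval-linearProduct g (suc n) w ⟨
    eval (suc (suc n)) cs w             ≈⟨ eval-last (suc n) cs w ⟩
    eval (suc n) cs w + cs (suc n) * pow R w (suc n)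
      ≈⟨ +-cong (trans (eval-constant n cs w gap) (linearProduct-constant g (suc n))) refl ⟩
    1# + cs (suc n) * pow R w (suc n)   ∎
    where
    cs : Poly
    cs = linearProduct g (suc n)

  IsIntegralDomain : Set (c ⊔ ℓ)
  IsIntegralDomain = ∀ a b → a * b ≈ 0# → a ≈ 0# ⊎ b ≈ 0#

  fixed⇒zero : IsIntegralDomain → ∀ a x → a * x ≈ x → ¬ a ≈ 1# → x ≈ 0#
  fixed⇒zero isDomain a x ax≈x a≉1 with isDomain (a - 1#) x [a-1]x≈0
    where
    [a-1]x≈0 : (a - 1#) * x ≈ 0#
    [a-1]x≈0 = begin
      (a - 1#) * x        ≈⟨ [y-z]x≈yx-zx x a 1# ⟩
      a * x - 1# * x      ≈⟨ +-cong ax≈x (-‿cong (*-identityˡ x)) ⟩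
      x - x               ≈⟨ -‿inverseʳ x ⟩
      0#                  ∎
  ... | inj₁ a-1≈0 = ⊥-elim (a≉1 (x∙y⁻¹≈ε⇒x≈y a 1# a-1≈0))
  ... | inj₂ x≈0   = x≈0

  HasOrder : Carrier → ℕ → Set ℓ
  HasOrder x n = pow R x n ≈ 1# × (∀ k → 0 < k → k < n → ¬ pow R x k ≈ 1#)

  pow-multiple : ∀ x n → pow R x n ≈ 1# → ∀ q → pow R x (q ℕ.* n) ≈ 1#
  pow-multiple x n xⁿ≈1 q = begin
    pow R x (q ℕ.* n)       ≡⟨ ≡.cong (pow R x) (ℕₚ.*-comm q n) ⟩
    pow R x (n ℕ.* q)       ≈⟨ pow-pow x n q ⟨
    pow R (pow R x n) q     ≈⟨ pow-cong q xⁿ≈1 ⟩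
    pow R 1# q              ≈⟨ pow-1# q ⟩
    1#                      ∎

  order-divides : ∀ x n .{{_ : NonZero n}} → HasOrder x n → ∀ k → pow R x k ≈ 1# → n ∣ k
  order-divides x n (xⁿ≈1 , minimal) k xᵏ≈1 with k % n ℕ.≟ 0
  ... | yes r≡0 = m%n≡0⇒n∣m k n r≡0
  ... | no  r≢0 = ⊥-elim (minimal (k % n) (ℕₚ.n≢0⇒n>0 r≢0) (m%n<n k n) xʳ≈1)
    where
    xʳ≈1 : pow R x (k % n) ≈ 1#
    xʳ≈1 = begin
      pow R x (k % n)                                  ≈⟨ *-identityʳ _ ⟨
      pow R x (k % n) * 1#                             ≈⟨ *-cong refl (pow-multiple x n xⁿ≈1 (k / n)) ⟨
      pow R x (k % n) * pow R x (k / n ℕ.* n)          ≈⟨ pow-+ x (k % n) (k / n ℕ.* n) ⟨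
      pow R x (k % n ℕ.+ k / n ℕ.* n)                  ≡⟨ ≡.cong (pow R x) (m≡m%n+[m/n]*n k n) ⟨
      pow R x k                                        ≈⟨ xᵏ≈1 ⟩
      1#                                               ∎

  pow-hasOrder : ∀ ζ m u α β .{{_ : NonZero m}} .{{_ : NonZero β}} →
    HasOrder ζ m → β ≡ gcd m u → α ℕ.* β ≡ m → HasOrder (pow R ζ u) α
  pow-hasOrder ζ m u α β order@(ζᵐ≈1 , _) β≡gcd αβ≡m with gcd[m,n]∣n m u
  ... | divides u' u≡u'·gcd = ηᵅ≈1 , minimal
    where
    u≡u'β : u ≡ u' ℕ.* β
    u≡u'β = ≡.trans u≡u'·gcd (≡.cong (u' ℕ.*_) (≡.sym β≡gcd))

    ηᵅ≈1 : pow R (pow R ζ u) α ≈ 1#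
    ηᵅ≈1 = begin
      pow R (pow R ζ u) α  ≈⟨ pow-pow ζ u α ⟩
      pow R ζ (u ℕ.* α)    ≡⟨ ≡.cong (pow R ζ) uα≡u'm ⟩
      pow R ζ (u' ℕ.* m)   ≈⟨ pow-multiple ζ m ζᵐ≈1 u' ⟩
      1#                   ∎
      where
      uα≡u'm : u ℕ.* α ≡ u' ℕ.* m
      uα≡u'm rewrite u≡u'β | ≡.sym αβ≡m =
        ≡.trans (ℕₚ.*-assoc u' β α) (≡.cong (u' ℕ.*_) (ℕₚ.*-comm β α))

    minimal : ∀ k → 0 < k → k < α → ¬ pow R (pow R ζ u) k ≈ 1#
    minimal k 0<k k<α ηᵏ≈1 = ℕₚ.<⇒≱ k<α (∣⇒≤ {{ℕ.>-nonZero 0<k}} α∣k)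
      where
      m∣uk : m ∣ u ℕ.* k
      m∣uk = order-divides ζ m order (u ℕ.* k) (trans (sym (pow-pow ζ u k)) ηᵏ≈1)
      uk≡u'kβ : u ℕ.* k ≡ (u' ℕ.* k) ℕ.* β
      uk≡u'kβ rewrite u≡u'β = ≡.trans (ℕₚ.*-assoc u' β k)
        (≡.trans (≡.cong (u' ℕ.*_) (ℕₚ.*-comm β k)) (≡.sym (ℕₚ.*-assoc u' k β)))
      α∣u'k : α ∣ u' ℕ.* k
      α∣u'k = *-cancelʳ-∣ β (≡.subst₂ _∣_ (≡.sym αβ≡m) uk≡u'kβ m∣uk)
      α∣k : α ∣ k
      α∣k = coprime-divisor (cofactors-coprime {u' = u'} β≡gcd αβ≡m u≡u'β) α∣u'k

  -- ∏_{j<α} (1 + ηʲ X) for ηᵅ = 1 is invariant under X ↦ ηX: its coefficients satisfy ηᵏ cₖ = cₖ.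
  rootProduct-invariant : ∀ η n → pow R η (suc n) ≈ 1# → ∀ k →
    pow R η k * linearProduct (pow R η) (suc n) k ≈ linearProduct (pow R η) (suc n) k
  rootProduct-invariant η n ηᵅ≈1 k = sym (begin
    linearProduct (pow R η) (suc n) k                   ≈⟨ linearProduct-first (pow R η) n k ⟩
    linearTimes 1# (linearProduct (pow R η ∘ suc) n) k  ≈⟨ linearTimes-cong (sym ηᵅ≈1) (λ _ → refl) k ⟩
    linearProduct (λ j → η * pow R η j) (suc n) k       ≈⟨ linearProduct-scale η (pow R η) (suc n) k ⟩
    pow R η k * linearProduct (pow R η) (suc n) k       ∎)

  -- c·(-1)ⁿ = -1 forces c·zⁿ = -(-z)ⁿ, because (-1)ⁿ is its own inverse.
  sign-flip : ∀ n c → c * pow R (- 1#) n ≈ - 1# → ∀ z → c * pow R z n ≈ - pow R (- z) n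
  sign-flip n c c·s≈-1 z = begin
    c * zⁿ                ≈⟨ *-identityʳ _ ⟨
    c * zⁿ * 1#           ≈⟨ *-cong refl (pow-[-1]-square n) ⟨
    c * zⁿ * (s * s)      ≈⟨ solve 3 (λ c x s → c :* x :* (s :* s) := (c :* s) :* (s :* x)) refl c zⁿ s ⟩
    (c * s) * (s * zⁿ)    ≈⟨ *-cong c·s≈-1 (sym [-z]ⁿ≈s·zⁿ) ⟩
    - 1# * pow R (- z) n  ≈⟨ -1*x≈-x _ ⟩
    - pow R (- z) n       ∎
    where
    s zⁿ : Carrier
    s  = pow R (- 1#) n
    zⁿ = pow R z n
    [-z]ⁿ≈s·zⁿ : pow R (- z) n ≈ s * zⁿ
    [-z]ⁿ≈s·zⁿ = trans (pow-cong n (sym (-1*x≈-x z))) (pow-* (- 1#) z n)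

  rootsOfUnity-product : IsIntegralDomain → ∀ η α .{{_ : NonZero α}} → HasOrder η α →
    ∀ z → ∏< α (λ j → 1# + z * pow R η j) ≈ 1# - pow R (- z) α
  rootsOfUnity-product isDomain η α@(suc n) (ηᵅ≈1 , minimal) z = begin
    ∏< α (λ j → 1# + z * pow R η j)  ≈⟨ expansion z ⟩
    1# + leading * pow R z α         ≈⟨ +-cong refl (sign-flip α leading leading·[-1]ᵅ≈-1 z) ⟩
    1# - pow R (- z) α               ∎
    where
    cs : Poly
    cs = linearProduct (pow R η) α
    leading : Carrier
    leading = cs α
    -- The middle coefficients are fixed by ηᵏ ≠ 1, hence zero.
    gap : ∀ k → 0 < k → k < α → cs k ≈ 0#
    gap k 0<k k<α =
      fixed⇒zero isDomain (pow R η k) (cs k) (rootProduct-invariant η n ηᵅ≈1 k) (minimal k 0<k k<α)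
    expansion : ∀ w → ∏< α (λ j → 1# + w * pow R η j) ≈ 1# + leading * pow R w α
    expansion = linearProduct-sparse (pow R η) n gap
    -- At w = -1 the factor j = 0 is 1 - 1 = 0, which pins down the leading coefficient.
    leading·[-1]ᵅ≈-1 : leading * pow R (- 1#) α ≈ - 1#
    leading·[-1]ᵅ≈-1 = +-inverseʳ-unique 1# _ (trans (sym (expansion (- 1#)))
      (∏<-vanishes n _ (trans (+-cong refl (*-identityʳ (- 1#))) (-‿inverseʳ 1#))))

  rootFactor-periodic : ∀ η α z → pow R η α ≈ 1# → ∀ j → 1# + z * pow R η (α ℕ.+ j) ≈ 1# + z * pow R η j
  rootFactor-periodic η α z ηᵅ≈1 j =
    +-cong refl (*-cong refl (trans (pow-+ η α j) (trans (*-cong ηᵅ≈1 refl) (*-identityˡ _))))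

  F-as-product : ∀ m y z → (1# + z) * F R (suc m) 1# y z ≈ ∏< (suc m) (λ j → 1# + z * pow R y j)
  F-as-product m y z =
    trans (*-cong (+-cong refl (sym (*-identityʳ z))) refl) (prodFrom1-∏< m (λ j → 1# + z * pow R y j))

-- The statement uses ℕ multiplication unqualified; it is imported only here
-- because inside RootsOfUnity _*_ is the ring multiplication.
open import Data.Nat using (_*_)

proposition5 : ∀ {c ℓ : Level} (R : CommutativeRing c ℓ) →
    let open CommutativeRing R renaming (_*_ to _·_) in
    (∀ a b → a · b ≈ 0# → a ≈ 0# ⊎ b ≈ 0#) →
    (ζ : Carrier) (m u α β : ℕ) → 0 < m → 0 < u →
    pow R ζ m ≈ 1# → (∀ k → 0 < k → k < m → ¬ (pow R ζ k ≈ 1#)) →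
    β ≡ gcd m u → α * β ≡ m →
    ∀ (z : Carrier) →
    (1# + z) · F R m 1# (pow R ζ u) z ≈ pow R (1# - pow R (- z) α) β
proposition5 R _ _ (suc _) _ α zero _ _ _ _ _ αβ≡m _ =
  ⊥-elim (ℕₚ.0≢1+n (≡.trans (≡.sym (ℕₚ.*-zeroʳ α)) αβ≡m))
proposition5 R isDomain ζ m@(suc m') u α@(suc _) β@(suc _) _ _ ζᵐ≈1 minimal β≡gcd αβ≡m z = begin
  (1# + z) · F R m 1# η z        ≈⟨ F-as-product m' η z ⟩
  ∏< m factor                    ≡⟨ ≡.cong (λ k → ∏< k factor) m≡βα ⟩
  ∏< (β * α) factor              ≈⟨ ∏<-periodic α factor (rootFactor-periodic η α z ηᵅ≈1) β ⟩
  pow R (∏< α factor) β          ≈⟨ pow-cong β (rootsOfUnity-product isDomain η α ηOrder z) ⟩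
  pow R (1# - pow R (- z) α) β   ∎
  where
  open CommutativeRing R using (_≈_; 1#; _+_; _-_; -_; setoid) renaming (_*_ to _·_)
  open import Relation.Binary.Reasoning.Setoid setoid
  open RootsOfUnity R
  η : CommutativeRing.Carrier R
  η = pow R ζ u
  factor : ℕ → CommutativeRing.Carrier R
  factor j = 1# + z · pow R η j
  ηOrder : HasOrder η α
  ηOrder = pow-hasOrder ζ m u α β (ζᵐ≈1 , minimal) β≡gcd αβ≡m
  ηᵅ≈1 : pow R η α ≈ 1#
  ηᵅ≈1 = proj₁ ηOrder
  m≡βα : m ≡ β * α
  m≡βα = ≡.trans (≡.sym αβ≡m) (ℕₚ.*-comm α β)
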